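{- Let $\vec S=\varprojlim(\vec S_p\mid p\in P)$ be a nested separation system that is the inverse limit of an inverse system of finite separation systems. Let $O$ be a consistent orientation of $\vec S$ with a greatest element $\vec m$. Then either $O$ is closed in $\vec S$, or $\vec m$ is co-small but not co-trivial and $\overleftarrow m$ lies in the closure of $O$ in $\vec S$.
   Context: A separation system is a poset with an order-reversing involution $\vec s\mapsto\overleftarrow s$; $s=\{\vec s,\overleftarrow s\}$. $\vec s$ is small if $\vec s\le\overleftarrow s$, co-small if $\overleftarrow s$ is small; $\vec r$ is trivial if there is $s\ne r$ with $\vec r<\vec s$, $\vec r<\overleftarrow s$, co-trivial if $\overleftarrow r$ is trivial. Nested: every two separations have comparable orientations. Orientation: exactly one orientation of each separation; consistent: no $\overleftarrow r,\vec s$ in it with $r\ne s$ and $\vec r<\vec s$. Inverse system: directed poset $P$, homomorphisms commuting with involutions and preserving $\le$, compatible; $\vec S$ = compatible families, componentwise order and involution, subspace topology of the product of discrete $\vec S_p$. -}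

module Defs where

open import Data.Nat using (ℕ)
open import Data.Fin using (Fin)
open import Data.Product using (Σ; ∃; ∃₂; _×_; _,_)
open import Data.Sum using (_⊎_)
open import Data.List using (List)
open import Data.List.Membership.Propositional using (_∈_)
open import Relation.Nullary using (¬_)
open import Relation.Binary.PropositionalEquality using (_≡_; cong; trans)
open import Relation.Binary.Structures using (IsPartialOrder)
open import Function.Bundles using (_↔_)

record SepSys : Set₁ where
  field
    Carrier        : Set
    _≤_            : Carrier → Carrier → Set
    isPartialOrder : IsPartialOrder _≡_ _≤_
    _*             : Carrier → Carrier
    involutive     : ∀ x → (x *) * ≡ x
    reversing      : ∀ {x y} → x ≤ y → (y *) ≤ (x *)

open SepSys public using (Carrier)

IsFinite : SepSys → Set
IsFinite S = ∃ λ (n : ℕ) → Carrier S ↔ Fin n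

record IsHom (S T : SepSys) (f : Carrier S → Carrier T) : Set where
  private
    module S = SepSys S
    module T = SepSys T
  field
    commutes : ∀ x → f (x S.*) ≡ (f x) T.*
    monotone : ∀ {x y} → x S.≤ y → f x T.≤ f y

record DirectedPoset : Set₁ where
  field
    Index          : Set
    _≼_            : Index → Index → Set
    isPartialOrder : IsPartialOrder _≡_ _≼_
    directed       : ∀ p q → ∃ λ r → (p ≼ r) × (q ≼ r)

open DirectedPoset public using (Index)

record InverseSystem (P : DirectedPoset) : Set₁ where
  open DirectedPoset P using (_≼_)
  field
    S        : Index P → SepSys
    f        : ∀ {p q} → p ≼ q → Carrier (S q) → Carrier (S p)
    hom      : ∀ {p q} (h : p ≼ q) → IsHom (S q) (S p) (f h)
    identity : ∀ {p} (h : p ≼ p) x → f h x ≡ x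
    compose  : ∀ {p q r} (h : p ≼ q) (k : q ≼ r) (l : p ≼ r) x →
               f l x ≡ f h (f k x)

module Limit {P : DirectedPoset} (I : InverseSystem P) where
  open DirectedPoset P using (_≼_)
  open InverseSystem I

  record Elem : Set where
    field
      at     : (p : Index P) → Carrier (S p)
      compat : ∀ {p q} (h : p ≼ q) → f h (at q) ≡ at p
  open Elem public

  _≈_ : Elem → Elem → Set
  x ≈ y = ∀ p → at x p ≡ at y p

  _≤_ : Elem → Elem → Set
  x ≤ y = ∀ p → SepSys._≤_ (S p) (at x p) (at y p)

  _<_ : Elem → Elem → Set
  x < y = (x ≤ y) × ¬ (x ≈ y)

  inv : Elem → Elem
  at (inv x) p = SepSys._* (S p) (at x p)
  compat (inv x) {p} {q} h =
    trans (IsHom.commutes (hom h) (at x q)) (cong (SepSys._* (S p)) (compat x h))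

  SameSep : Elem → Elem → Set
  SameSep x y = (x ≈ y) ⊎ (x ≈ inv y)

  Nested : Set
  Nested = ∀ x y → (x ≤ y) ⊎ (x ≤ inv y) ⊎ (inv x ≤ y) ⊎ (inv x ≤ inv y)

  -- O is a subset of the limit (respects equality of families)
  IsSubset : (Elem → Set) → Set
  IsSubset O = ∀ x y → x ≈ y → O x → O y

  IsOrientation : (Elem → Set) → Set
  IsOrientation O = (∀ x → O x ⊎ O (inv x)) × (∀ x → O x → O (inv x) → x ≈ inv x)

  Consistent : (Elem → Set) → Set
  Consistent O = ¬ (∃₂ λ r s → O (inv r) × O s × ¬ SameSep r s × (r < s))

  Greatest : (Elem → Set) → Elem → Set
  Greatest O m = O m × (∀ x → O x → x ≤ m)

  Small : Elem → Set
  Small x = x ≤ inv x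

  CoSmall : Elem → Set
  CoSmall x = Small (inv x)

  Trivial : Elem → Set
  Trivial r = ∃ λ s → ¬ SameSep s r × (r < s) × (r < inv s)

  CoTrivial : Elem → Set
  CoTrivial r = Trivial (inv r)

  -- closure in the subspace topology of the product of the discrete S_p:
  -- every basic open neighbourhood (fixing finitely many coordinates) meets O
  InClosure : (Elem → Set) → Elem → Set
  InClosure O x = ∀ (F : List (Index P)) →
    ∃ λ y → O y × (∀ {p} → p ∈ F → at y p ≡ at x p)

  Closed : (Elem → Set) → Set
  Closed O = ∀ x → InClosure O x → O x

open Limit public

-- Every point x of the closure of O lies below m, since m bounds O in each
-- coordinate. If x ∉ O then x* ∈ O, and consistency forbids x < m unless x is
-- an orientation of m; as x ≠ m this forces x = m*. So O can fail to be closed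
-- only at m*, and then m* ≤ m says that m is co-small. Finally m is never
-- co-trivial: if m* < s and m* < s*, the orientation t ∈ O of s has t* < m with
-- t ≠ m*, which again contradicts consistency.
module Submission where

open import Defs
open import Level using (0ℓ)
open import Data.Product using (_×_; _,_; proj₁; proj₂)
open import Data.Sum using (_⊎_; inj₁; inj₂)
open import Data.List using ([]; _∷_)
open import Data.List.Relation.Unary.Any using (here)
open import Data.Empty using (⊥-elim)
open import Relation.Nullary using (¬_; yes; no)
open import Relation.Binary.PropositionalEquality using (refl; sym; trans; cong; subst)
open import Function using (_∘_)
open import Axiom.ExcludedMiddle using (ExcludedMiddle)

module LimitProperties {P : DirectedPoset} (I : InverseSystem P) where

  open InverseSystem I using (S)
  private
    module S p = SepSys (S p)
    _≈ᴵ_ : Elem I → Elem I → Set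
    _≈ᴵ_ = _≈_ I
    _≤ᴵ_ : Elem I → Elem I → Set
    _≤ᴵ_ = _≤_ I
    _<ᴵ_ : Elem I → Elem I → Set
    _<ᴵ_ = _<_ I
    _* : Elem I → Elem I
    _* = inv I

    infix 4 _≈ᴵ_ _≤ᴵ_ _<ᴵ_
    infix 10 _*

  inv-involutive : ∀ x → x * * ≈ᴵ x
  inv-involutive x p = S.involutive p (at x p)

  ≤-inv-involutiveʳ : ∀ x y → x ≤ᴵ y → x ≤ᴵ y * *
  ≤-inv-involutiveʳ x y x≤y p = subst (S._≤_ p (at x p)) (sym (inv-involutive y p)) (x≤y p)

  inv-≤-swap : ∀ x y → x * ≤ᴵ y → y * ≤ᴵ x
  inv-≤-swap x y x*≤y p =
    subst (S._≤_ p (at (y *) p)) (inv-involutive x p) (S.reversing p (x*≤y p))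

  closure-below-upperBound : (O : Elem I → Set) (m : Elem I) → (∀ y → O y → y ≤ᴵ m) →
    ∀ x → InClosure I O x → x ≤ᴵ m
  closure-below-upperBound O m bound x x∈cl p with x∈cl (p ∷ [])
  ... | y , y∈O , y≡x = subst (λ z → S._≤_ p z (at m p)) (y≡x (here refl)) (bound y y∈O p)

  module ConsistentOrientation {O : Elem I → Set} (resp : IsSubset I O) (orient : IsOrientation I O)
           (consistent : Consistent I O) {m : Elem I} (greatest : Greatest I O m) where

    private
      m∈O : O m
      m∈O = proj₁ greatest

      closure-below-m : ∀ x → InClosure I O x → x ≤ᴵ m
      closure-below-m = closure-below-upperBound O m (proj₂ greatest)

    closurePoint∉O⇒≈inv-greatest : ExcludedMiddle 0ℓ →
      ∀ x → InClosure I O x → ¬ O x → x ≈ᴵ m *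
    closurePoint∉O⇒≈inv-greatest em x x∈cl x∉O with em {x ≈ᴵ m *}
    ... | yes x≈m* = x≈m*
    ... | no x≉m* with proj₁ orient x
    ...   | inj₁ x∈O = ⊥-elim (x∉O x∈O)
    ...   | inj₂ x*∈O =
      ⊥-elim (consistent (x , m , x*∈O , m∈O , x≁m , closure-below-m x x∈cl , x≉m))
      where
      x≉m : ¬ x ≈ᴵ m
      x≉m x≈m = x∉O (resp m x (sym ∘ x≈m) m∈O)
      x≁m : ¬ SameSep I x m
      x≁m (inj₁ x≈m) = x≉m x≈m
      x≁m (inj₂ x≈m*) = x≉m* x≈m*

    closed-if-closedAt-inv-greatest : ExcludedMiddle 0ℓ →
      (InClosure I O (m *) → O (m *)) → Closed I O
    closed-if-closedAt-inv-greatest em closedAt-m* x x∈cl with em {O x}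
    ... | yes x∈O = x∈O
    ... | no x∉O = resp (m *) x (sym ∘ x≈m*) (closedAt-m* m*∈cl)
      where
      x≈m* : x ≈ᴵ m *
      x≈m* = closurePoint∉O⇒≈inv-greatest em x x∈cl x∉O
      m*∈cl : InClosure I O (m *)
      m*∈cl F with x∈cl F
      ... | y , y∈O , y≡x = y , y∈O , λ p∈F → trans (y≡x p∈F) (x≈m* _)

    inv-greatest∈closure⇒coSmall : InClosure I O (m *) → CoSmall I m
    inv-greatest∈closure⇒coSmall m*∈cl =
      ≤-inv-involutiveʳ (m *) m (closure-below-m (m *) m*∈cl)

    inv-greatest<both-orientations⇒∉O : ∀ t → m * <ᴵ t → m * <ᴵ t * → ¬ O t
    inv-greatest<both-orientations⇒∉O t (m*≤t , m*≉t) (_ , m*≉t*) t∈O =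
      consistent (t * , m , t**∈O , m∈O , t*≁m , inv-≤-swap m t m*≤t , t*≉m)
      where
      t**∈O : O (t * *)
      t**∈O = resp t (t * *) (sym ∘ inv-involutive t) t∈O
      t*≉m : ¬ t * ≈ᴵ m
      t*≉m t*≈m = m*≉t λ p → trans (cong (S._* p) (sym (t*≈m p))) (inv-involutive t p)
      t*≁m : ¬ SameSep I (t *) m
      t*≁m (inj₁ t*≈m) = t*≉m t*≈m
      t*≁m (inj₂ t*≈m*) = m*≉t* (sym ∘ t*≈m*)

    greatest⇒¬coTrivial : ¬ CoTrivial I m
    greatest⇒¬coTrivial (s , _ , m*<s , m*<s*) with proj₁ orient s
    ... | inj₁ s∈O = inv-greatest<both-orientations⇒∉O s m*<s m*<s* s∈O
    ... | inj₂ s*∈O = inv-greatest<both-orientations⇒∉O (s *) m*<s* m*<s** s*∈O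
      where
      m*<s** : m * <ᴵ s * *
      m*<s** = ≤-inv-involutiveʳ (m *) s (proj₁ m*<s)
             , λ m*≈s** → proj₂ m*<s λ p → trans (m*≈s** p) (inv-involutive s p)

    closed⊎inv-greatest-limitPoint : ExcludedMiddle 0ℓ →
      Closed I O ⊎ (CoSmall I m × ¬ CoTrivial I m × InClosure I O (m *))
    closed⊎inv-greatest-limitPoint em with em {O (m *)} | em {InClosure I O (m *)}
    ... | yes m*∈O | _ = inj₁ (closed-if-closedAt-inv-greatest em (λ _ → m*∈O))
    ... | no _ | yes m*∈cl =
      inj₂ (inv-greatest∈closure⇒coSmall m*∈cl , greatest⇒¬coTrivial , m*∈cl)
    ... | no _ | no m*∉cl =
      inj₁ (closed-if-closedAt-inv-greatest em (λ m*∈cl → ⊥-elim (m*∉cl m*∈cl)))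

lemma7p2 : ExcludedMiddle 0ℓ →
    (P : DirectedPoset) (I : InverseSystem P) →
    (∀ p → IsFinite (InverseSystem.S I p)) →
    Nested I →
    (O : Elem I → Set) → IsSubset I O → IsOrientation I O → Consistent I O →
    (m : Elem I) → Greatest I O m →
    Closed I O ⊎ (CoSmall I m × ¬ CoTrivial I m × InClosure I O (inv I m))
lemma7p2 em P I _ _ O resp orient consistent m greatest =
  LimitProperties.ConsistentOrientation.closed⊎inv-greatest-limitPoint I resp orient consistent greatest em
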